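{- (Commutativity of the hamiltonian-cycle resampling oracle.) Let $\mathfrak U$ be the set of permutations of $[n]$ consisting of a single $n$-cycle, with $\Omega$ uniform on $\mathfrak U$, and let the atomic events, dependency relation and resampling oracle be as in the context. Then property (C3) holds: for any paths $q,q'$ with $\langle q\rangle\not\sim\langle q'\rangle$, any $\pi\in\langle q\rangle\cap\langle q'\rangle$, and any $w\in\mathfrak U$, if $\sigma$ is uniform on $Y_{\langle q\rangle}$ and $\sigma'$ uniform on $Y_{\langle q'\rangle}$, independent, then $P(\sigma'\lambda^{q'}\sigma\lambda^{q}\pi = w \mid \sigma\lambda^q\pi\in\langle q'\rangle) = P(\sigma\lambda^{q}\sigma'\lambda^{q'}\pi = w \mid \sigma'\lambda^{q'}\pi\in\langle q\rangle)$.
   Context: A hamiltonian cycle $(x_1,\dots,x_n,x_1)$ of $K_n$ is encoded as the $n$-cycle permutation $(x_1\ x_2\ \cdots\ x_n)$. Permutations multiply as functional composition ($\sigma_1\sigma_2=\sigma_1\circ\sigma_2$); $(a\ b)$ is a transposition. A path is $q=(x_1,\dots,x_k)$ with $x_1,\dots,x_k$ distinct elements of $[n]$, and $\langle q\rangle=\{\pi\in\mathfrak U:\pi(x_i)=x_{i+1}\text{ for }1\le i<k\}$. Define $\langle q\rangle\sim\langle q'\rangle$ iff $\{x_1,\dots,x_k\}$ and the support of $q'$ intersect. For a list $x_1,\dots,x_j$ of distinct elements, $T(\{x_1,\dots,x_j\})=\{(x_j\ z_j)\cdots(x_1\ z_1) : z_i\in[n]\setminus\{x_i,\dots,x_j\}\}$.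 For $q=(x_1,\dots,x_k)$, $\lambda^q$ is the cycle $(x_k\ x_{k-1}\ \cdots\ x_1)$, $Y_{\langle q\rangle}$ is the uniform distribution on $T(\{x_1,\dots,x_{k-1}\})$, and the resampling map is $r_{\langle q\rangle}(\pi,\sigma)=\sigma\lambda^q\pi$ for $\pi\in\langle q\rangle$, $\sigma\in Y_{\langle q\rangle}$. -}

module Defs where

open import Data.Nat using (ℕ; zero; suc; _*_; _≤_)
open import Data.Fin using (Fin; toℕ; _≟_)
open import Data.Fin.Properties using (any?; all?)
open import Data.Fin.Permutation.Components using (transpose)
open import Data.List using (List; []; _∷_; length; filter; concatMap; map; reverse; allFin; cartesianProduct)
open import Data.List.Membership.Propositional using (_∈_; _∉_)
open import Data.List.Membership.DecPropositional using () renaming (_∈?_ to ∈?-with)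
open import Data.List.Relation.Unary.Unique.Propositional using (Unique)
open import Data.Product using (Σ; ∃; _×_; _,_; proj₁; proj₂)
open import Data.Unit using (⊤; tt)
open import Function using (id; _∘_)
open import Relation.Nullary using (Dec; yes; no; ¬_)
open import Relation.Nullary.Decidable using (_×-dec_; ¬?)
open import Relation.Binary.PropositionalEquality using (_≡_)

-- Maps [n] → [n]; permutations are those that are bijective.
-- Composition is functional composition: (σ₁ σ₂) = σ₁ ∘ σ₂.
Fun : ℕ → Set
Fun n = Fin n → Fin n

iter : ∀ {n} → Fun n → ℕ → Fin n → Fin n
iter f zero    x = x
iter f (suc k) x = f (iter f k x)

-- π is a single n-cycle (an element of 𝔘): every y lies in the orbit of
-- every x (orbits of a self-map of [n] are reached within n steps).
-- This forces π to be a bijection with one orbit of size n.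
IsNCycle : ∀ {n} → Fun n → Set
IsNCycle {n} π = ∀ (x y : Fin n) → ∃ λ (k : Fin n) → iter π (toℕ k) x ≡ y

isNCycle? : ∀ {n} (π : Fun n) → Dec (IsNCycle π)
isNCycle? π = all? λ x → all? λ y → any? λ k → iter π (toℕ k) x ≟ y

IsPath : ∀ {n} → List (Fin n) → Set
IsPath q = Unique q × (1 ≤ length q)

Follows : ∀ {n} → List (Fin n) → Fun n → Set
Follows []            π = ⊤
Follows (x ∷ [])      π = ⊤
Follows (x ∷ y ∷ rest) π = (π x ≡ y) × Follows (y ∷ rest) π

follows? : ∀ {n} (q : List (Fin n)) (π : Fun n) → Dec (Follows q π)
follows? []             π = yes tt
follows? (x ∷ [])       π = yes tt
follows? (x ∷ y ∷ rest) π = (π x ≟ y) ×-dec follows? (y ∷ rest) π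

InEvent : ∀ {n} → List (Fin n) → Fun n → Set
InEvent q π = IsNCycle π × Follows q π

inEvent? : ∀ {n} (q : List (Fin n)) (π : Fun n) → Dec (InEvent q π)
inEvent? q π = isNCycle? π ×-dec follows? q π

Dependent : ∀ {n} → List (Fin n) → List (Fin n) → Set
Dependent q q' = ∃ λ x → (x ∈ q) × (x ∈ q')

-- The cycle (a₁ a₂ ⋯ a_m): a₁ ↦ a₂ ↦ ⋯ ↦ a_m ↦ a₁, all other points fixed.
cycleGo : ∀ {n} → Fin n → Fin n → List (Fin n) → Fun n
cycleGo first a []         y with y ≟ a
... | yes _ = first
... | no  _ = y
cycleGo first a (b ∷ rest) y with y ≟ a
... | yes _ = b
... | no  _ = cycleGo first b rest y

cycle : ∀ {n} → List (Fin n) → Fun n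
cycle []       = id
cycle (a ∷ as) = cycleGo a a as

lam : ∀ {n} → List (Fin n) → Fun n
lam q = cycle (reverse q)

dropLast : ∀ {A : Set} → List A → List A
dropLast []            = []
dropLast (x ∷ [])      = []
dropLast (x ∷ y ∷ rest) = x ∷ dropLast (y ∷ rest)

-- Enumeration of T({x₁,…,x_j}) = {(x_j z_j)⋯(x₁ z₁) : zᵢ ∈ [n] ∖ {xᵢ,…,x_j}},
-- one entry per choice of (z₁,…,z_j):
--   (x_j z_j)⋯(x₂ z₂)(x₁ z₁) = τ ∘ (x₁ z₁) with τ ∈ T({x₂,…,x_j}).
-- (The map (z₁,…,z_j) ↦ product is injective, so the uniform distribution
--  on this list is the uniform distribution on the set T.)
Tlist : ∀ {n} → List (Fin n) → List (Fun n)
Tlist {n} []       = id ∷ []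
Tlist {n} (x ∷ xs) =
  concatMap (λ z → map (λ τ → τ ∘ transpose x z) (Tlist xs))
            (filter (λ z → ¬? (∈?-with _≟_ z (x ∷ xs))) (allFin n))

-- support of Y_⟨q⟩ (uniform distribution on T({x₁,…,x_{k-1}}))
Ylist : ∀ {n} → List (Fin n) → List (Fun n)
Ylist q = Tlist (dropLast q)

resample : ∀ {n} → List (Fin n) → Fun n → Fun n → Fun n
resample q π σ = σ ∘ lam q ∘ π

EqFun : ∀ {n} → Fun n → Fun n → Set
EqFun f g = ∀ x → f x ≡ g x

eqFun? : ∀ {n} (f g : Fun n) → Dec (EqFun f g)
eqFun? f g = all? λ x → f x ≟ g x

count : ∀ {A : Set} {P : A → Set} → (∀ a → Dec (P a)) → List A → ℕ
count P? xs = length (filter P? xs)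

-- Sample space for (σ, σ'), σ ~ Y_⟨q⟩, σ' ~ Y_⟨q'⟩ independent (uniform on the product).
Pairs : ∀ {n} → List (Fin n) → List (Fin n) → List (Fun n × Fun n)
Pairs q q' = cartesianProduct (Ylist q) (Ylist q')

-- Left side: event B_L = {σλ^qπ ∈ ⟨q'⟩}, event A_L = B_L ∩ {σ'λ^{q'}σλ^qπ = w}
numL denL numR denR : ∀ {n} → List (Fin n) → List (Fin n) → Fun n → Fun n → ℕ
denL q q' π w = count (λ p → inEvent? q' (resample q π (proj₁ p))) (Pairs q q')
numL q q' π w = count (λ p → inEvent? q' (resample q π (proj₁ p))
                           ×-dec eqFun? (resample q' (resample q π (proj₁ p)) (proj₂ p)) w)
                      (Pairs q q')
-- Right side: B_R = {σ'λ^{q'}π ∈ ⟨q⟩}, A_R = B_R ∩ {σλ^qσ'λ^{q'}π = w}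
denR q q' π w = count (λ p → inEvent? q (resample q' π (proj₂ p))) (Pairs q q')
numR q q' π w = count (λ p → inEvent? q (resample q' π (proj₂ p))
                           ×-dec eqFun? (resample q (resample q' π (proj₂ p)) (proj₁ p)) w)
                      (Pairs q q')

module Submission where

-- Let A, B be q, q' without their last vertices.  Both sides of (C3) are
-- ratios of counts of pairs (σ, σ') ∈ T(A) × T(B); we show that the
-- numerators agree and the denominators agree.  For a property D of
-- permutations let  hits L ρ = #{τ ∈ T(L) : D(τ ρ)}.
--  1. hits L ρ does not depend on the order of L (hits-↭).  The key case
--     exchanges two adjacent vertices; the products of transpositions are
--     rearranged by conjugation, f (i j) = (f i  f j) f.
--  2. Resampling along q and then q' hits D exactly hits (A ++ B) (λ^{q'} λ^q π)
--     times (resample-sum).  This is an induction over the transpositions of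
--     σ ∈ T(A) with the invariant CyclicOff: the partial product fixes the
--     vertices still to be resampled and is a single cycle on the others.  A
--     transposition (x z) with z on the tail of q' rules out ⟨q'⟩; any other
--     one is carried through λ^{q'} by conjugation.
--  3. λ^q and λ^{q'} commute for disjoint paths, so by 1 and 2 the two orders
--     of resampling give the same counts (pairCount-symmetric).

open import Defs
open import Data.Nat using (ℕ; zero; suc; _+_; _*_; _∸_; _≤_; _<_; z≤n; s≤s; s≤s⁻¹; _<?_; _≤?_)
open import Data.Nat.Properties
  using (+-assoc; +-comm; +-identityʳ; *-identityʳ; *-zeroʳ; *-distribˡ-+;
         m∸n+n≡m; m∸n≤m; +-monoʳ-<; ≤-trans; <-≤-trans; ≮⇒≥; ≰⇒>; <-irrefl; ≤-refl)
open import Data.Fin using (Fin; toℕ; _≟_; fromℕ<; punchOut) renaming (zero to fzero; suc to fsuc)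
open import Data.Fin.Properties using (toℕ-fromℕ<; toℕ<n; pigeonhole; punchOut-injective; any?; 0≢1+n; suc-injective)
open import Data.Fin.Permutation.Components using (transpose; transpose-inverse)
open import Data.List
  using (List; []; _∷_; _∷ʳ_; _++_; length; filter; concatMap; concat; map; reverse; allFin; tabulate; cartesianProduct)
open import Data.List.Properties using (unfold-reverse; reverse-++; ++-assoc)
open import Data.List.Membership.Propositional using (_∈_; _∉_)
open import Data.List.Membership.Propositional.Properties using (∈-++⁺ˡ; ∈-++⁺ʳ; ∈-++⁻)
import Data.List.Membership.DecPropositional as DecMembership
open import Data.List.Relation.Unary.Any using (here; there)
import Data.List.Relation.Unary.Any.Properties as Any
open import Data.List.Relation.Unary.All.Properties using (¬Any⇒All¬)
open import Data.List.Relation.Unary.AllPairs using ([]; _∷_)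
open import Data.List.Relation.Unary.Unique.Propositional using (Unique)
open import Data.List.Relation.Unary.Unique.Propositional.Properties using (Unique[x∷xs]⇒x∉xs; ++⁺)
import Data.List.Relation.Binary.Permutation.Propositional as Perm
open Perm using (_↭_; ↭-sym; ↭⇒↭ₛ)
import Data.List.Relation.Binary.Permutation.Setoid.Properties as PermSetoid
open import Data.List.Relation.Binary.Permutation.Propositional.Properties using (∈-resp-↭; ++-comm)
open import Data.Product using (Σ; _×_; _,_; proj₁; proj₂)
open import Data.Sum using (_⊎_; inj₁; inj₂; [_,_]′)
open import Data.Unit using (⊤; tt)
open import Data.Empty using (⊥-elim)
open import Function using (id; _∘_)
open import Relation.Nullary using (Dec; yes; no; ¬_)
open import Relation.Nullary.Decidable using (_×-dec_; ¬?; dec-true; dec-false)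
open import Relation.Binary.PropositionalEquality

when : ∀ {P : Set} → Dec P → ℕ → ℕ
when (yes _) c = c
when (no _)  _ = 0

when-yes : ∀ {P : Set} (d : Dec P) {c} → P → when d c ≡ c
when-yes (yes _) p = refl
when-yes (no ¬p) p = ⊥-elim (¬p p)

when-no : ∀ {P : Set} (d : Dec P) {c} → ¬ P → when d c ≡ 0
when-no (yes p) ¬p = ⊥-elim (¬p p)
when-no (no _)  ¬p = refl

when-cong : ∀ {P Q : Set} (d : Dec P) (e : Dec Q) {x y} →
  (P → Q) → (Q → P) → (P → x ≡ y) → when d x ≡ when e y
when-cong (yes p) (yes q) f g h = h p
when-cong (yes p) (no ¬q) f g h = ⊥-elim (¬q (f p))
when-cong (no ¬p) (yes q) f g h = ⊥-elim (¬p (g q))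
when-cong (no _)  (no _)  f g h = refl

when-× : ∀ {P Q : Set} (d : Dec P) (e : Dec Q) → when (d ×-dec e) 1 ≡ when d 1 * when e 1
when-× (yes _) (yes _) = refl
when-× (yes _) (no _)  = refl
when-× (no _)  e       = refl

when-when : ∀ {P Q : Set} (d : Dec P) (e : Dec Q) c → when d (when e c) ≡ when (d ×-dec e) c
when-when (yes _) (yes _) c = refl
when-when (yes _) (no _)  c = refl
when-when (no _)  e       c = refl

when-+ : ∀ {P : Set} (d : Dec P) x y → when d (x + y) ≡ when d x + when d y
when-+ (yes _) x y = refl
when-+ (no _)  x y = refl

ΣL : ∀ {A : Set} → (A → ℕ) → List A → ℕ
ΣL f []       = 0
ΣL f (x ∷ xs) = f x + ΣL f xs

module _ {A : Set} where

  ΣL-cong : ∀ {f g : A → ℕ} l → (∀ a → f a ≡ g a) → ΣL f l ≡ ΣL g l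
  ΣL-cong []      e = refl
  ΣL-cong (x ∷ l) e = cong₂ _+_ (e x) (ΣL-cong l e)

  ΣL-zero : ∀ (f : A → ℕ) l → (∀ a → f a ≡ 0) → ΣL f l ≡ 0
  ΣL-zero f []      e = refl
  ΣL-zero f (x ∷ l) e rewrite e x = ΣL-zero f l e

  ΣL-++ : ∀ (f : A → ℕ) l m → ΣL f (l ++ m) ≡ ΣL f l + ΣL f m
  ΣL-++ f []      m = refl
  ΣL-++ f (x ∷ l) m rewrite ΣL-++ f l m = sym (+-assoc (f x) _ _)

  ΣL-+ : ∀ (f g : A → ℕ) l → ΣL (λ a → f a + g a) l ≡ ΣL f l + ΣL g l
  ΣL-+ f g []      = refl
  ΣL-+ f g (x ∷ l) rewrite ΣL-+ f g l = interchange (f x) (g x) (ΣL f l) (ΣL g l)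
    where
    interchange : ∀ a b c d → a + b + (c + d) ≡ a + c + (b + d)
    interchange a b c d = begin
      a + b + (c + d)   ≡⟨ +-assoc a b (c + d) ⟩
      a + (b + (c + d)) ≡⟨ cong (a +_) (sym (+-assoc b c d)) ⟩
      a + (b + c + d)   ≡⟨ cong (λ t → a + (t + d)) (+-comm b c) ⟩
      a + (c + b + d)   ≡⟨ cong (a +_) (+-assoc c b d) ⟩
      a + (c + (b + d)) ≡⟨ sym (+-assoc a c (b + d)) ⟩
      a + c + (b + d)   ∎
      where open ≡-Reasoning

  ΣL-*ˡ : ∀ c (f : A → ℕ) l → ΣL (λ a → c * f a) l ≡ c * ΣL f l
  ΣL-*ˡ c f []      = sym (*-zeroʳ c)
  ΣL-*ˡ c f (x ∷ l) rewrite ΣL-*ˡ c f l = sym (*-distribˡ-+ c (f x) (ΣL f l))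

  when-ΣL : ∀ {P : Set} (d : Dec P) (f : A → ℕ) l → when d (ΣL f l) ≡ ΣL (λ a → when d (f a)) l
  when-ΣL (yes _) f l = refl
  when-ΣL (no _)  f l = sym (ΣL-zero _ l (λ _ → refl))

  ΣL-filter : ∀ {P : A → Set} (P? : ∀ a → Dec (P a)) (f : A → ℕ) l →
    ΣL f (filter P? l) ≡ ΣL (λ a → when (P? a) (f a)) l
  ΣL-filter P? f []      = refl
  ΣL-filter P? f (x ∷ l) with P? x
  ... | yes _ = cong (f x +_) (ΣL-filter P? f l)
  ... | no _  = ΣL-filter P? f l

  count≡ΣL : ∀ {P : A → Set} (P? : ∀ a → Dec (P a)) l → count P? l ≡ ΣL (λ a → when (P? a) 1) l
  count≡ΣL P? []      = refl
  count≡ΣL P? (x ∷ l) with P? x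
  ... | yes _ = cong suc (count≡ΣL P? l)
  ... | no _  = count≡ΣL P? l

ΣL-map : ∀ {A B : Set} (f : B → ℕ) (g : A → B) l → ΣL f (map g l) ≡ ΣL (f ∘ g) l
ΣL-map f g []      = refl
ΣL-map f g (x ∷ l) = cong (f (g x) +_) (ΣL-map f g l)

module _ {A B : Set} where

  ΣL-concatMap : ∀ (f : B → ℕ) (g : A → List B) l → ΣL f (concatMap g l) ≡ ΣL (λ a → ΣL f (g a)) l
  ΣL-concatMap f g []      = refl
  ΣL-concatMap f g (x ∷ l) =
    trans (ΣL-++ f (g x) (concat (map g l))) (cong (ΣL f (g x) +_) (ΣL-concatMap f g l))

  ΣL-swap : ∀ (F : A → B → ℕ) l m → ΣL (λ a → ΣL (F a) m) l ≡ ΣL (λ b → ΣL (λ a → F a b) l) m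
  ΣL-swap F []      m = sym (ΣL-zero _ m (λ _ → refl))
  ΣL-swap F (x ∷ l) m rewrite ΣL-swap F l m = sym (ΣL-+ (F x) (λ b → ΣL (λ a → F a b) l) m)

  ΣL-cartesianProduct : ∀ (F : A × B → ℕ) l m →
    ΣL F (cartesianProduct l m) ≡ ΣL (λ a → ΣL (λ b → F (a , b)) m) l
  ΣL-cartesianProduct F []      m = refl
  ΣL-cartesianProduct F (x ∷ l) m = trans (ΣL-++ F (map (x ,_) m) (cartesianProduct l m))
    (cong₂ _+_ (ΣL-map F (x ,_) m) (ΣL-cartesianProduct F l m))

ΣL-δ : ∀ {n} (a : Fin n) c → ΣL (λ z → when (z ≟ a) c) (allFin n) ≡ c
ΣL-δ {n} a c = go id (λ e → e) a refl
  where
  miss : ∀ {k} (g : Fin k → Fin n) → (∀ i → g i ≢ a) → ΣL (λ z → when (z ≟ a) c) (tabulate g) ≡ 0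
  miss {zero}  g h = refl
  miss {suc k} g h rewrite when-no (g fzero ≟ a) {c} (h fzero) = miss (g ∘ fsuc) (h ∘ fsuc)
  go : ∀ {k} (g : Fin k → Fin n) → (∀ {i j} → g i ≡ g j → i ≡ j) → ∀ i → g i ≡ a →
    ΣL (λ z → when (z ≟ a) c) (tabulate g) ≡ c
  go g inj fzero e rewrite when-yes (g fzero ≟ a) {c} e =
    trans (cong (c +_) (miss (g ∘ fsuc) (λ i e' → 0≢1+n (inj (trans e (sym e')))))) (+-identityʳ c)
  go g inj (fsuc i) e rewrite when-no (g fzero ≟ a) {c} (λ e' → 0≢1+n (inj (trans e' (sym e)))) =
    go (g ∘ fsuc) (λ e' → suc-injective (inj e')) i e

ΣL-δ-+ : ∀ {n} (a : Fin n) c (K : Fin n → ℕ) → ΣL (λ z → when (z ≟ a) c + K z) (allFin n) ≡ c + ΣL K (allFin n)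
ΣL-δ-+ {n} a c K = trans (ΣL-+ (λ z → when (z ≟ a) c) K (allFin n)) (cong (_+ ΣL K (allFin n)) (ΣL-δ a c))

module _ {A : Set} where

  Unique-tail : ∀ {x : A} {xs} → Unique (x ∷ xs) → Unique xs
  Unique-tail (_ ∷ u) = u

  Unique-cons : ∀ {x : A} {xs} → x ∉ xs → Unique xs → Unique (x ∷ xs)
  Unique-cons x∉xs u = ¬Any⇒All¬ _ x∉xs ∷ u

  Unique-++ˡ : ∀ (xs : List A) {ys} → Unique (xs ++ ys) → Unique xs
  Unique-++ˡ []       u = []
  Unique-++ˡ (x ∷ xs) u =
    Unique-cons (λ m → Unique[x∷xs]⇒x∉xs u (∈-++⁺ˡ m)) (Unique-++ˡ xs (Unique-tail u))

  Unique-++-disjoint : ∀ (xs : List A) {ys a} → Unique (xs ++ ys) → a ∈ xs → a ∉ ys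
  Unique-++-disjoint (x ∷ xs) u (here refl) m = Unique[x∷xs]⇒x∉xs u (∈-++⁺ʳ xs m)
  Unique-++-disjoint (x ∷ xs) u (there p)   m = Unique-++-disjoint xs (Unique-tail u) p m

  Unique-reverse : ∀ (xs : List A) → Unique xs → Unique (reverse xs)
  Unique-reverse []       u = []
  Unique-reverse (x ∷ xs) u rewrite unfold-reverse x xs =
    ++⁺ (Unique-reverse xs (Unique-tail u)) (Unique-cons (λ ()) [])
        (λ { (p , here refl) → Unique[x∷xs]⇒x∉xs u (Any.reverse⁻ p) })

  last : A → List A → A
  last a []      = a
  last a (b ∷ r) = last b r

  dropLast-∷ʳ-last : ∀ (x : A) t → dropLast (x ∷ t) ∷ʳ last x t ≡ x ∷ t
  dropLast-∷ʳ-last x []      = refl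
  dropLast-∷ʳ-last x (b ∷ r) = cong (x ∷_) (dropLast-∷ʳ-last b r)

  ∈-dropLast : ∀ {x : A} {t c} → c ∈ dropLast (x ∷ t) → c ∈ x ∷ t
  ∈-dropLast {x} {t} m = subst (_ ∈_) (dropLast-∷ʳ-last x t) (∈-++⁺ˡ m)

  last-∈ : ∀ (x : A) t → last x t ∈ x ∷ t
  last-∈ x t = subst (last x t ∈_) (dropLast-∷ʳ-last x t) (∈-++⁺ʳ (dropLast (x ∷ t)) (here refl))

  ∈-dropLast-or-last : ∀ {x : A} {t c} → c ∈ x ∷ t → c ∈ dropLast (x ∷ t) ⊎ c ≡ last x t
  ∈-dropLast-or-last {x} {t} m with ∈-++⁻ (dropLast (x ∷ t)) (subst (_ ∈_) (sym (dropLast-∷ʳ-last x t)) m)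
  ... | inj₁ p        = inj₁ p
  ... | inj₂ (here e) = inj₂ e

  Unique-dropLast : ∀ {x : A} {t} → Unique (x ∷ t) → Unique (dropLast (x ∷ t))
  Unique-dropLast {x} {t} u = Unique-++ˡ _ (subst Unique (sym (dropLast-∷ʳ-last x t)) u)

  last∉dropLast : ∀ {x : A} {t} → Unique (x ∷ t) → last x t ∉ dropLast (x ∷ t)
  last∉dropLast {x} {t} u m =
    Unique-++-disjoint _ (subst Unique (sym (dropLast-∷ʳ-last x t)) u) m (here refl)

  tail : List A → List A
  tail []       = []
  tail (x ∷ xs) = xs

  ∈-tail : ∀ {a : A} l → a ∈ tail l → a ∈ l
  ∈-tail (x ∷ l) p = there p

  data Adjacent : List A → A → A → Set where
    front : ∀ {a b r} → Adjacent (a ∷ b ∷ r) a b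
    later : ∀ {c l a b} → Adjacent l a b → Adjacent (c ∷ l) a b

  Adjacent⇒∈dropLast : ∀ {l a b} → Adjacent l a b → a ∈ dropLast l
  Adjacent⇒∈dropLast front                   = here refl
  Adjacent⇒∈dropLast (later {c} {d ∷ r} p) = there (Adjacent⇒∈dropLast p)

  ∈dropLast⇒Adjacent : ∀ l {a} → a ∈ dropLast l → Σ A (Adjacent l a)
  ∈dropLast⇒Adjacent (x ∷ y ∷ r) (here refl) = y , front
  ∈dropLast⇒Adjacent (x ∷ y ∷ r) (there p) with ∈dropLast⇒Adjacent (y ∷ r) p
  ... | b , adj = b , later adj

  ∈tail⇒Adjacent : ∀ l {b} → b ∈ tail l → Σ A λ a → Adjacent l a b
  ∈tail⇒Adjacent (x ∷ y ∷ r) (here refl) = x , front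
  ∈tail⇒Adjacent (x ∷ y ∷ r) (there p) with ∈tail⇒Adjacent (y ∷ r) p
  ... | a , adj = a , later adj

  Adjacent-++ : ∀ {l a b} m → Adjacent l a b → Adjacent (l ++ m) a b
  Adjacent-++ m front     = front
  Adjacent-++ m (later p) = later (Adjacent-++ m p)

  Adjacent-reverse : ∀ {l a b} → Adjacent l a b → Adjacent (reverse l) b a
  Adjacent-reverse (front {a} {b} {r}) = subst (λ l → Adjacent l b a) (sym reverse-ab) (middle (reverse r))
    where
    middle : ∀ m → Adjacent (m ++ b ∷ a ∷ []) b a
    middle []      = front
    middle (x ∷ m) = later (middle m)
    reverse-ab : reverse (a ∷ b ∷ r) ≡ reverse r ++ b ∷ a ∷ []
    reverse-ab = trans (unfold-reverse a (b ∷ r))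
      (trans (cong (_∷ʳ a) (unfold-reverse b r)) (++-assoc (reverse r) (b ∷ []) (a ∷ [])))
  Adjacent-reverse (later {c} {l} p) rewrite unfold-reverse c l = Adjacent-++ (c ∷ []) (Adjacent-reverse p)

_∈?_ : ∀ {n} (z : Fin n) (l : List (Fin n)) → Dec (z ∈ l)
z ∈? l = DecMembership._∈?_ _≟_ z l

_∉?_ : ∀ {n} (z : Fin n) (l : List (Fin n)) → Dec (z ∉ l)
z ∉? l = DecMembership._∉?_ _≟_ z l

module _ {n : ℕ} where

  Follows-adjacent : ∀ {l : List (Fin n)} {f a b} → Follows l f → Adjacent l a b → f a ≡ b
  Follows-adjacent (e , _) front = e
  Follows-adjacent {c ∷ d ∷ r} (_ , F) (later p) = Follows-adjacent F p

  Follows-post : ∀ (l : List (Fin n)) {f} (g : Fun n) → Follows l f → (∀ y → y ∈ tail l → g y ≡ y) →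
    Follows l (g ∘ f)
  Follows-post []          g F       h = tt
  Follows-post (x ∷ [])    g F       h = tt
  Follows-post (x ∷ y ∷ r) g (e , F) h =
    trans (cong g e) (h y (here refl)) , Follows-post (y ∷ r) g F (λ z p → h z (there p))

  Follows-cong : ∀ (l : List (Fin n)) {f g : Fun n} → (∀ y → y ∈ l → f y ≡ g y) → Follows l g → Follows l f
  Follows-cong []          h F       = tt
  Follows-cong (x ∷ [])    h F       = tt
  Follows-cong (x ∷ y ∷ r) h (e , F) = trans (h x (here refl)) e , Follows-cong (y ∷ r) (λ z p → h z (there p)) F

  cycleGo-outside : ∀ (first a : Fin n) rest y → y ∉ a ∷ rest → cycleGo first a rest y ≡ y
  cycleGo-outside first a []         y m with y ≟ a
  ... | yes e = ⊥-elim (m (here e))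
  ... | no _  = refl
  cycleGo-outside first a (b ∷ rest) y m with y ≟ a
  ... | yes e = ⊥-elim (m (here e))
  ... | no _  = cycleGo-outside first b rest y (m ∘ there)

  cycleGo-range : ∀ (first a : Fin n) rest y →
    cycleGo first a rest y ≡ y ⊎ cycleGo first a rest y ∈ first ∷ a ∷ rest
  cycleGo-range first a []         y with y ≟ a
  ... | yes _ = inj₂ (here refl)
  ... | no _  = inj₁ refl
  cycleGo-range first a (b ∷ rest) y with y ≟ a
  ... | yes _ = inj₂ (there (there (here refl)))
  ... | no _ with cycleGo-range first b rest y
  ...   | inj₁ e         = inj₁ e
  ...   | inj₂ (here e)  = inj₂ (here e)
  ...   | inj₂ (there p) = inj₂ (there (there p))

  cycleGo-follows : ∀ (first a : Fin n) rest → Unique (a ∷ rest) → Follows (a ∷ rest) (cycleGo first a rest)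
  cycleGo-follows first a []         u = tt
  cycleGo-follows first a (b ∷ rest) u with a ≟ a
  ... | no a≢a = ⊥-elim (a≢a refl)
  ... | yes _  = refl , Follows-cong (b ∷ rest) agree (cycleGo-follows first b rest (Unique-tail u))
    where
    agree : ∀ y → y ∈ b ∷ rest → cycleGo first a (b ∷ rest) y ≡ cycleGo first b rest y
    agree y p with y ≟ a
    ... | yes refl = ⊥-elim (Unique[x∷xs]⇒x∉xs u p)
    ... | no _     = refl

  cycleGo-last : ∀ (first a : Fin n) mid e → Unique (a ∷ (mid ∷ʳ e)) → cycleGo first a (mid ∷ʳ e) e ≡ first
  cycleGo-last first a [] e u with e ≟ a
  ... | yes refl = ⊥-elim (Unique[x∷xs]⇒x∉xs u (here refl))
  ... | no _ with e ≟ e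
  ...   | yes _  = refl
  ...   | no e≢e = ⊥-elim (e≢e refl)
  cycleGo-last first a (m ∷ mid) e u with e ≟ a
  ... | yes refl = ⊥-elim (Unique[x∷xs]⇒x∉xs u (∈-++⁺ʳ (m ∷ mid) (here refl)))
  ... | no _     = cycleGo-last first m mid e (Unique-tail u)

  cycle-outside : ∀ (l : List (Fin n)) y → y ∉ l → cycle l y ≡ y
  cycle-outside []      y m = refl
  cycle-outside (a ∷ l) y m = cycleGo-outside a a l y m

  cycle-range : ∀ (l : List (Fin n)) y → cycle l y ≡ y ⊎ cycle l y ∈ l
  cycle-range []      y = inj₁ refl
  cycle-range (a ∷ l) y with cycleGo-range a a l y
  ... | inj₁ e         = inj₁ e
  ... | inj₂ (here e)  = inj₂ (here e)
  ... | inj₂ (there p) = inj₂ p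

  lam-outside : ∀ (q : List (Fin n)) y → y ∉ q → lam q y ≡ y
  lam-outside q y m = cycle-outside (reverse q) y (m ∘ Any.reverse⁻)

  lam-range : ∀ (q : List (Fin n)) y → lam q y ≡ y ⊎ lam q y ∈ q
  lam-range q y with cycle-range (reverse q) y
  ... | inj₁ e = inj₁ e
  ... | inj₂ p = inj₂ (Any.reverse⁻ p)

  lam-adjacent : ∀ {q : List (Fin n)} {a b} → Unique q → Adjacent q a b → lam q b ≡ a
  lam-adjacent {[]}    u ()
  lam-adjacent {x ∷ q} u adj with reverse (x ∷ q) | Unique-reverse (x ∷ q) u | Adjacent-reverse adj
  ... | c ∷ l | ul | adjʳ = Follows-adjacent (cycleGo-follows c c l ul) adjʳ

  lam-head : ∀ (x : Fin n) t → Unique (x ∷ t) → lam (x ∷ t) x ≡ last x t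
  lam-head x []      u with x ≟ x
  ... | yes _  = refl
  ... | no x≢x = ⊥-elim (x≢x refl)
  lam-head x (b ∷ r) u = trans (cong (λ l → cycle l x) reverse-q)
    (cycleGo-last (last b r) (last b r) mid x (subst Unique reverse-q (Unique-reverse (x ∷ b ∷ r) u)))
    where
    mid : List (Fin n)
    mid = reverse (dropLast (b ∷ r))
    reverse-q : reverse (x ∷ b ∷ r) ≡ last b r ∷ (mid ∷ʳ x)
    reverse-q = begin
      reverse (x ∷ b ∷ r)                         ≡⟨ cong reverse (sym (dropLast-∷ʳ-last x (b ∷ r))) ⟩
      reverse ((x ∷ dropLast (b ∷ r)) ∷ʳ last b r) ≡⟨ reverse-++ (x ∷ dropLast (b ∷ r)) (last b r ∷ []) ⟩
      last b r ∷ reverse (x ∷ dropLast (b ∷ r))    ≡⟨ cong (last b r ∷_) (unfold-reverse x (dropLast (b ∷ r))) ⟩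
      last b r ∷ (mid ∷ʳ x)                        ∎
      where open ≡-Reasoning

  lam-undoes : ∀ {q : List (Fin n)} {π} → Unique q → Follows q π → ∀ c → c ∈ dropLast q → lam q (π c) ≡ c
  lam-undoes {q} u F c m with ∈dropLast⇒Adjacent q m
  ... | d , adj rewrite Follows-adjacent F adj = lam-adjacent u adj

  lam-tail : ∀ {q : List (Fin n)} → Unique q → ∀ c → c ∈ tail q → lam q c ∈ dropLast q
  lam-tail {q} u c m with ∈tail⇒Adjacent q m
  ... | d , adj rewrite lam-adjacent u adj = Adjacent⇒∈dropLast adj

  -- λ^q and λ^{q'} commute when q and q' are disjoint: each moves only
  -- vertices of its own path and keeps them inside it.
  lam-commute : ∀ (q q' : List (Fin n)) → (∀ c → c ∈ q → c ∉ q') → ∀ c → lam q' (lam q c) ≡ lam q (lam q' c)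
  lam-commute q q' disjoint c with lam-range q c
  ... | inj₂ m = trans (lam-outside q' (lam q c) (disjoint _ m))
                       (cong (lam q) (sym (lam-outside q' c (disjoint c (moved m)))))
    where
    moved : lam q c ∈ q → c ∈ q
    moved m with c ∈? q
    ... | yes c∈q = c∈q
    ... | no c∉q  = subst (_∈ q) (lam-outside q c c∉q) m
  ... | inj₁ fixed with lam-range q' c
  ...   | inj₁ fixed' = trans (cong (lam q') fixed) (trans fixed' (sym (trans (cong (lam q) fixed') fixed)))
  ...   | inj₂ m'     = trans (cong (lam q') fixed) (sym (lam-outside q (lam q' c) (λ m → disjoint _ m m')))

-- Transpositions.  All identities between products of transpositions used
-- below are instances of conjugation, f ∘ (i j) = (f i  f j) ∘ f.
module _ {n : ℕ} where

  transpose-i : ∀ (i j : Fin n) → transpose i j i ≡ j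
  transpose-i i j rewrite dec-true (i ≟ i) refl = refl

  transpose-j : ∀ (i j : Fin n) → transpose i j j ≡ i
  transpose-j i j with j ≟ i
  ... | yes e = e
  ... | no _ rewrite dec-true (j ≟ j) refl = refl

  transpose-other : ∀ (i j k : Fin n) → k ≢ i → k ≢ j → transpose i j k ≡ k
  transpose-other i j k k≢i k≢j rewrite dec-false (k ≟ i) k≢i | dec-false (k ≟ j) k≢j = refl

  transpose-conj : ∀ (f : Fun n) (i j : Fin n) → (∀ c → f c ≡ f i → c ≡ i) → (∀ c → f c ≡ f j → c ≡ j) →
    ∀ c → f (transpose i j c) ≡ transpose (f i) (f j) (f c)
  transpose-conj f i j inj-i inj-j c = cases (c ≟ i) (c ≟ j)
    where
    cases : Dec (c ≡ i) → Dec (c ≡ j) → f (transpose i j c) ≡ transpose (f i) (f j) (f c)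
    cases (yes refl) _          = trans (cong f (transpose-i c j)) (sym (transpose-i (f c) (f j)))
    cases (no c≢i)   (yes refl) = trans (cong f (transpose-j i c)) (sym (transpose-j (f i) (f c)))
    cases (no c≢i)   (no c≢j)   = trans (cong f (transpose-other i j c c≢i c≢j))
                                    (sym (transpose-other (f i) (f j) (f c) (c≢i ∘ inj-i c) (c≢j ∘ inj-j c)))

  transpose-injective : ∀ (i j : Fin n) {c d} → transpose i j c ≡ transpose i j d → c ≡ d
  transpose-injective i j e =
    trans (sym (transpose-inverse j i)) (trans (cong (transpose j i) e) (transpose-inverse j i))

  transpose-shared-left : ∀ (a b z c : Fin n) → a ≢ b → z ≢ b →
    transpose b a (transpose a z c) ≡ transpose a z (transpose b z c)
  transpose-shared-left a b z c a≢b z≢b = sym (trans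
    (transpose-conj (transpose a z) b z (λ _ → transpose-injective a z) (λ _ → transpose-injective a z) c)
    (cong₂ (λ u v → transpose u v (transpose a z c))
           (transpose-other a z b (a≢b ∘ sym) (z≢b ∘ sym)) (transpose-j a z)))

  transpose-shared-right : ∀ (a b z c : Fin n) → a ≢ b → z ≢ a →
    transpose b z (transpose a z c) ≡ transpose a b (transpose b z c)
  transpose-shared-right a b z c a≢b z≢a = trans
    (transpose-conj (transpose b z) a z (λ _ → transpose-injective b z) (λ _ → transpose-injective b z) c)
    (cong₂ (λ u v → transpose u v (transpose b z c))
           (transpose-other b z a a≢b (z≢a ∘ sym)) (transpose-j b z))

  transpose-disjoint : ∀ (a b z u c : Fin n) → a ≢ u → z ≢ b → z ≢ u → a ≢ b →
    transpose b u (transpose a z c) ≡ transpose a z (transpose b u c)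
  transpose-disjoint a b z u c a≢u z≢b z≢u a≢b = trans
    (transpose-conj (transpose b u) a z (λ _ → transpose-injective b u) (λ _ → transpose-injective b u) c)
    (cong₂ (λ v w → transpose v w (transpose b u c))
           (transpose-other b u a a≢b a≢u) (transpose-other b u z z≢b z≢u))

  -- λ^{q'} (x z) = (x  λ^{q'} z) λ^{q'} for x off q' and z off the tail of
  -- q': λ^{q'} fixes x and is injective at x and at z.
  lam-conj : ∀ (y : Fin n) ys → Unique (y ∷ ys) → ∀ x z → x ∉ y ∷ ys → z ∉ ys →
    ∀ c → lam (y ∷ ys) (transpose x z c) ≡ transpose x (lam (y ∷ ys) z) (lam (y ∷ ys) c)
  lam-conj y ys u' x z x∉ z∉ys c = trans (transpose-conj λ' x z injective-at-x injective-at-z c)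
                                         (cong (λ v → transpose v (λ' z) (λ' c)) (lam-outside q' x x∉))
    where
    q' : List (Fin n)
    q' = y ∷ ys
    λ' : Fun n
    λ' = lam q'
    injective-at-x : ∀ c → λ' c ≡ λ' x → c ≡ x
    injective-at-x c e with lam-range q' c
    ... | inj₁ fixed = trans (sym fixed) (trans e (lam-outside q' x x∉))
    ... | inj₂ m     = ⊥-elim (x∉ (subst (_∈ q') (trans e (lam-outside q' x x∉)) m))
    injective-at-z : ∀ c → λ' c ≡ λ' z → c ≡ z
    injective-at-z c e with z ∈? q' | c ∈? q'
    ... | no z∉ | _ =
      [ (λ fixed → trans (sym fixed) e′) , (λ m → ⊥-elim (z∉ (subst (_∈ q') e′ m))) ]′ (lam-range q' c)
      where
      e′ : λ' c ≡ z
      e′ = trans e (lam-outside q' z z∉)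
    ... | yes (there m)   | _                = ⊥-elim (z∉ys m)
    ... | yes (here refl) | yes (here refl)  = refl
    ... | yes (here refl) | yes (there m)    =
      ⊥-elim (last∉dropLast u' (subst (_∈ dropLast q') (trans e (lam-head y ys u')) (lam-tail u' c m)))
    ... | yes (here refl) | no c∉ =
      ⊥-elim (c∉ (subst (_∈ q') (sym (trans (sym (lam-outside q' c c∉)) (trans e (lam-head y ys u')))) (last-∈ y ys)))

module _ {n : ℕ} where

  ΣT-cons : ∀ (x : Fin n) xs (f : Fun n → ℕ) → ΣL f (Tlist (x ∷ xs)) ≡
    ΣL (λ z → when (z ∉? (x ∷ xs)) (ΣL (λ τ → f (τ ∘ transpose x z)) (Tlist xs))) (allFin n)
  ΣT-cons x xs f = begin
    ΣL f (concatMap (λ z → map (_∘ transpose x z) (Tlist xs)) (filter (_∉? (x ∷ xs)) (allFin n)))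
      ≡⟨ ΣL-concatMap f (λ z → map (_∘ transpose x z) (Tlist xs)) (filter (_∉? (x ∷ xs)) (allFin n)) ⟩
    ΣL (λ z → ΣL f (map (_∘ transpose x z) (Tlist xs))) (filter (_∉? (x ∷ xs)) (allFin n))
      ≡⟨ ΣL-filter (_∉? (x ∷ xs)) _ (allFin n) ⟩
    ΣL (λ z → when (z ∉? (x ∷ xs)) (ΣL f (map (_∘ transpose x z) (Tlist xs)))) (allFin n)
      ≡⟨ ΣL-cong (allFin n) (λ z → cong (when (z ∉? (x ∷ xs))) (ΣL-map f _ (Tlist xs))) ⟩
    ΣL (λ z → when (z ∉? (x ∷ xs)) (ΣL (λ τ → f (τ ∘ transpose x z)) (Tlist xs))) (allFin n) ∎
    where open ≡-Reasoning

  -- τ sends each point off xs to itself or into xs, as every τ ∈ T(xs) does.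
  KeepsOutside : List (Fin n) → Fun n → Set
  KeepsOutside xs τ = ∀ c → c ∉ xs → τ c ≡ c ⊎ τ c ∈ xs

  ΣT-vanish : ∀ xs → Unique xs → (f : Fun n → ℕ) → (∀ τ → KeepsOutside xs τ → f τ ≡ 0) → ΣL f (Tlist xs) ≡ 0
  ΣT-vanish []       _ f h = cong (_+ 0) (h id (λ c _ → inj₁ refl))
  ΣT-vanish (x ∷ xs) u f h = trans (ΣT-cons x xs f) (ΣL-zero _ (allFin n) summand)
    where
    summand : ∀ z → when (z ∉? (x ∷ xs)) (ΣL (λ τ → f (τ ∘ transpose x z)) (Tlist xs)) ≡ 0
    summand z with z ∉? (x ∷ xs)
    ... | no _     = refl
    ... | yes z∉xs = ΣT-vanish xs (Unique-tail u) _ (λ τ k → h _ (extend τ k))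
      where
      extend : ∀ τ → KeepsOutside xs τ → KeepsOutside (x ∷ xs) (τ ∘ transpose x z)
      extend τ k c c∉ with c ≟ z
      ... | yes refl rewrite transpose-j x c = [ inj₂ ∘ here , inj₂ ∘ there ]′ (k x (Unique[x∷xs]⇒x∉xs u))
      ... | no c≢z rewrite transpose-other x z c (c∉ ∘ here) c≢z = [ inj₁ , inj₂ ∘ there ]′ (k c (c∉ ∘ there))

  ΣL-split-two : ∀ (L : List (Fin n)) e z (H : Fin n → ℕ) → e ∉ L → z ∉ e ∷ L →
    ΣL (λ u → when (u ∉? L) (H u)) (allFin n) ≡
    H e + (H z + ΣL (λ u → when ((u ∉? (e ∷ L)) ×-dec ¬? (u ≟ z)) (H u)) (allFin n))
  ΣL-split-two L e z H e∉L z∉ = begin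
    ΣL (λ u → when (u ∉? L) (H u)) (allFin n)
      ≡⟨ ΣL-cong (allFin n) (λ u → summand u (u ≟ e) (u ≟ z)) ⟩
    ΣL (λ u → when (u ≟ e) (H e) + (when (u ≟ z) (H z) + rest u)) (allFin n)
      ≡⟨ ΣL-+ (λ u → when (u ≟ e) (H e)) _ (allFin n) ⟩
    ΣL (λ u → when (u ≟ e) (H e)) (allFin n) + ΣL (λ u → when (u ≟ z) (H z) + rest u) (allFin n)
      ≡⟨ cong₂ _+_ (ΣL-δ e (H e)) (ΣL-+ (λ u → when (u ≟ z) (H z)) rest (allFin n)) ⟩
    H e + (ΣL (λ u → when (u ≟ z) (H z)) (allFin n) + ΣL rest (allFin n))
      ≡⟨ cong (λ t → H e + (t + ΣL rest (allFin n))) (ΣL-δ z (H z)) ⟩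
    H e + (H z + ΣL rest (allFin n)) ∎
    where
    open ≡-Reasoning
    rest : Fin n → ℕ
    rest u = when ((u ∉? (e ∷ L)) ×-dec ¬? (u ≟ z)) (H u)
    summand : ∀ u → Dec (u ≡ e) → Dec (u ≡ z) →
      when (u ∉? L) (H u) ≡ when (u ≟ e) (H e) + (when (u ≟ z) (H z) + rest u)
    summand u (yes refl) _ rewrite when-yes (u ∉? L) {H u} e∉L | when-yes (u ≟ u) {H u} refl
                                 | when-no (u ≟ z) {H z} (λ u≡z → z∉ (here (sym u≡z)))
                                 | when-no ((u ∉? (u ∷ L)) ×-dec ¬? (u ≟ z)) {H u} (λ p → proj₁ p (here refl)) =
      sym (+-identityʳ (H u))
    summand u (no u≢e) (yes refl) rewrite when-yes (u ∉? L) {H u} (z∉ ∘ there) | when-no (u ≟ e) {H e} u≢e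
                                        | when-yes (u ≟ u) {H u} refl
                                        | when-no ((u ∉? (e ∷ L)) ×-dec ¬? (u ≟ u)) {H u} (λ p → proj₂ p refl) =
      sym (+-identityʳ (H u))
    summand u (no u≢e) (no u≢z) rewrite when-no (u ≟ e) {H e} u≢e | when-no (u ≟ z) {H z} u≢z =
      when-cong (u ∉? L) ((u ∉? (e ∷ L)) ×-dec ¬? (u ≟ z))
        (λ u∉L → [ u≢e , u∉L ]′ ∘ split , u≢z) (λ p → proj₁ p ∘ there) (λ _ → refl)
      where
      split : u ∈ e ∷ L → u ≡ e ⊎ u ∈ L
      split (here e)  = inj₁ e
      split (there m) = inj₂ m

  Unique-↭ : ∀ {xs ys : List (Fin n)} → xs ↭ ys → Unique xs → Unique ys
  Unique-↭ p = PermSetoid.Unique-resp-↭ (setoid _) (↭⇒↭ₛ p)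

  ∉-swap : ∀ {a b z : Fin n} {r} → z ∉ a ∷ b ∷ r → z ∉ b ∷ a ∷ r
  ∉-swap z∉ (here e)          = z∉ (there (here e))
  ∉-swap z∉ (there (here e))  = z∉ (here e)
  ∉-swap z∉ (there (there m)) = z∉ (there (there m))

module Hits {n : ℕ} (D : Fun n → Set) (D? : ∀ f → Dec (D f)) (D-resp : ∀ {f g} → EqFun f g → D f → D g) where

  hits : List (Fin n) → Fun n → ℕ
  hits xs ρ = ΣL (λ τ → when (D? (τ ∘ ρ)) 1) (Tlist xs)

  hits-cons : ∀ x xs ρ → hits (x ∷ xs) ρ ≡ ΣL (λ z → when (z ∉? (x ∷ xs)) (hits xs (transpose x z ∘ ρ))) (allFin n)
  hits-cons x xs ρ = ΣT-cons x xs (λ τ → when (D? (τ ∘ ρ)) 1)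

  hits-cong : ∀ xs {ρ ρ'} → EqFun ρ ρ' → hits xs ρ ≡ hits xs ρ'
  hits-cong xs e = ΣL-cong (Tlist xs) (λ τ → when-cong (D? _) (D? _)
    (D-resp (cong τ ∘ e)) (D-resp (cong τ ∘ sym ∘ e)) (λ _ → refl))

  -- Expanding hits (a ∷ b ∷ r) two levels deep, τ = τ' (b u) (a z), and
  -- splitting the choice of u ∉ b ∷ r into u = a, u = z, and u outside
  -- a ∷ b ∷ r distinct from z, gives three parts.
  twoStep : List (Fin n) → Fun n → Fin n → Fin n → Fin n → Fin n → ℕ
  twoStep r ρ a b z u = hits r (transpose b u ∘ transpose a z ∘ ρ)

  part₁ part₂ part₃ : List (Fin n) → Fun n → Fin n → Fin n → ℕ
  part₁ r ρ a b = ΣL (λ z → when (z ∉? (a ∷ b ∷ r)) (twoStep r ρ a b z a)) (allFin n)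
  part₂ r ρ a b = ΣL (λ z → when (z ∉? (a ∷ b ∷ r)) (twoStep r ρ a b z z)) (allFin n)
  part₃ r ρ a b = ΣL (λ z → when (z ∉? (a ∷ b ∷ r))
    (ΣL (λ u → when ((u ∉? (a ∷ b ∷ r)) ×-dec ¬? (u ≟ z)) (twoStep r ρ a b z u)) (allFin n))) (allFin n)

  hits-expand : ∀ a b r ρ → Unique (a ∷ b ∷ r) →
    hits (a ∷ b ∷ r) ρ ≡ part₁ r ρ a b + (part₂ r ρ a b + part₃ r ρ a b)
  hits-expand a b r ρ u = trans (hits-cons a (b ∷ r) ρ) (trans (ΣL-cong (allFin n) summand)
      (trans (ΣL-+ S₁ (λ z → S₂ z + S₃ z) (allFin n)) (cong (ΣL S₁ (allFin n) +_) (ΣL-+ S₂ S₃ (allFin n)))))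
    where
    guard : ∀ z → Dec (z ∉ a ∷ b ∷ r)
    guard z = z ∉? (a ∷ b ∷ r)
    S₁ S₂ S₃ : Fin n → ℕ
    S₁ z = when (guard z) (twoStep r ρ a b z a)
    S₂ z = when (guard z) (twoStep r ρ a b z z)
    S₃ z = when (guard z) (ΣL (λ u → when ((u ∉? (a ∷ b ∷ r)) ×-dec ¬? (u ≟ z)) (twoStep r ρ a b z u)) (allFin n))
    summand : ∀ z → when (guard z) (hits (b ∷ r) (transpose a z ∘ ρ)) ≡ S₁ z + (S₂ z + S₃ z)
    summand z = trans
      (when-cong (guard z) (guard z) id id (λ z∉ → trans (hits-cons b r (transpose a z ∘ ρ))
        (ΣL-split-two (b ∷ r) a z (twoStep r ρ a b z) (Unique[x∷xs]⇒x∉xs u) z∉)))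
      (trans (when-+ (guard z) _ _) (cong (S₁ z +_) (when-+ (guard z) _ _)))

  -- Exchanging a and b turns the first part into the second, since
  -- (b a)(a z) = (a z)(b z) for z ∉ a ∷ b ∷ r ...
  part₁-swap : ∀ r ρ {a b} → a ≢ b → part₁ r ρ a b ≡ part₂ r ρ b a
  part₁-swap r ρ {a} {b} a≢b = ΣL-cong (allFin n) λ z →
    when-cong (z ∉? (a ∷ b ∷ r)) (z ∉? (b ∷ a ∷ r)) ∉-swap ∉-swap
      (λ z∉ → hits-cong r (λ c → transpose-shared-left a b z (ρ c) a≢b (z∉ ∘ there ∘ here)))

  -- ... and the second into the first, since (b z)(a z) = (a b)(b z) ...
  part₂-swap : ∀ r ρ {a b} → a ≢ b → part₂ r ρ a b ≡ part₁ r ρ b a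
  part₂-swap r ρ {a} {b} a≢b = ΣL-cong (allFin n) λ z →
    when-cong (z ∉? (a ∷ b ∷ r)) (z ∉? (b ∷ a ∷ r)) ∉-swap ∉-swap
      (λ z∉ → hits-cong r (λ c → transpose-shared-right a b z (ρ c) a≢b (z∉ ∘ here)))

  -- ... while in the third part (a z) and (b v) are disjoint and commute, so
  -- exchanging a, b amounts to exchanging the summation variables z, v.
  part₃-swap : ∀ r ρ {a b} → a ≢ b → part₃ r ρ a b ≡ part₃ r ρ b a
  part₃-swap r ρ {a} {b} a≢b = begin
    part₃ r ρ a b
      ≡⟨ ΣL-cong (allFin n) (λ z → trans (when-ΣL (z ∉? (a ∷ b ∷ r)) _ (allFin n))
                                         (ΣL-cong (allFin n) (λ v → when-when (z ∉? (a ∷ b ∷ r)) _ _))) ⟩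
    ΣL (λ z → ΣL (λ v → when (guard a b z v) (twoStep r ρ a b z v)) (allFin n)) (allFin n)
      ≡⟨ ΣL-swap _ (allFin n) (allFin n) ⟩
    ΣL (λ v → ΣL (λ z → when (guard a b z v) (twoStep r ρ a b z v)) (allFin n)) (allFin n)
      ≡⟨ ΣL-cong (allFin n) (λ v → ΣL-cong (allFin n) (λ z → exchange v z)) ⟩
    ΣL (λ v → ΣL (λ z → when (guard b a v z) (twoStep r ρ b a v z)) (allFin n)) (allFin n)
      ≡⟨ sym (ΣL-cong (allFin n) (λ v → trans (when-ΣL (v ∉? (b ∷ a ∷ r)) _ (allFin n))
                                                (ΣL-cong (allFin n) (λ z → when-when (v ∉? (b ∷ a ∷ r)) _ _)))) ⟩
    part₃ r ρ b a ∎
    where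
    open ≡-Reasoning
    guard : ∀ a b z v → Dec (z ∉ a ∷ b ∷ r × v ∉ a ∷ b ∷ r × v ≢ z)
    guard a b z v = (z ∉? (a ∷ b ∷ r)) ×-dec ((v ∉? (a ∷ b ∷ r)) ×-dec ¬? (v ≟ z))
    exchange : ∀ v z → when (guard a b z v) (twoStep r ρ a b z v) ≡ when (guard b a v z) (twoStep r ρ b a v z)
    exchange v z = when-cong (guard a b z v) (guard b a v z)
      (λ { (z∉ , v∉ , v≢z) → ∉-swap v∉ , ∉-swap z∉ , v≢z ∘ sym })
      (λ { (v∉ , z∉ , z≢v) → ∉-swap z∉ , ∉-swap v∉ , z≢v ∘ sym })
      (λ { (z∉ , v∉ , v≢z) → hits-cong r (λ c → transpose-disjoint a b z v (ρ c)
             (v∉ ∘ here ∘ sym) (z∉ ∘ there ∘ here) (v≢z ∘ sym) a≢b) })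

  hits-swap : ∀ a b r ρ → Unique (a ∷ b ∷ r) → hits (a ∷ b ∷ r) ρ ≡ hits (b ∷ a ∷ r) ρ
  hits-swap a b r ρ u = begin
    hits (a ∷ b ∷ r) ρ
      ≡⟨ hits-expand a b r ρ u ⟩
    part₁ r ρ a b + (part₂ r ρ a b + part₃ r ρ a b)
      ≡⟨ cong₂ (λ s t → s + (t + part₃ r ρ a b)) (part₁-swap r ρ a≢b) (part₂-swap r ρ a≢b) ⟩
    part₂ r ρ b a + (part₁ r ρ b a + part₃ r ρ a b)
      ≡⟨ cong (λ t → part₂ r ρ b a + (part₁ r ρ b a + t)) (part₃-swap r ρ a≢b) ⟩
    part₂ r ρ b a + (part₁ r ρ b a + part₃ r ρ b a)
      ≡⟨ swap-summands (part₂ r ρ b a) (part₁ r ρ b a) (part₃ r ρ b a) ⟩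
    part₁ r ρ b a + (part₂ r ρ b a + part₃ r ρ b a)
      ≡⟨ sym (hits-expand b a r ρ (Unique-↭ (Perm.swap a b Perm.refl) u)) ⟩
    hits (b ∷ a ∷ r) ρ ∎
    where
    open ≡-Reasoning
    a≢b : a ≢ b
    a≢b e = Unique[x∷xs]⇒x∉xs u (here e)
    swap-summands : ∀ x y w → x + (y + w) ≡ y + (x + w)
    swap-summands x y w = trans (sym (+-assoc x y w)) (trans (cong (_+ w) (+-comm x y)) (+-assoc y x w))

  hits-prep : ∀ x {xs ys} → (∀ ρ → hits xs ρ ≡ hits ys ρ) →
    (∀ {z} → z ∈ xs → z ∈ ys) → (∀ {z} → z ∈ ys → z ∈ xs) → ∀ ρ → hits (x ∷ xs) ρ ≡ hits (x ∷ ys) ρ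
  hits-prep x {xs} {ys} same xs⊆ys ys⊆xs ρ =
    trans (hits-cons x xs ρ) (trans (ΣL-cong (allFin n) summand) (sym (hits-cons x ys ρ)))
    where
    summand : ∀ z →
      when (z ∉? (x ∷ xs)) (hits xs (transpose x z ∘ ρ)) ≡ when (z ∉? (x ∷ ys)) (hits ys (transpose x z ∘ ρ))
    summand z = when-cong (z ∉? (x ∷ xs)) (z ∉? (x ∷ ys))
      (λ z∉ → λ { (here e) → z∉ (here e) ; (there p) → z∉ (there (ys⊆xs p)) })
      (λ z∉ → λ { (here e) → z∉ (here e) ; (there p) → z∉ (there (xs⊆ys p)) })
      (λ _ → same _)

  hits-↭ : ∀ {xs ys} → xs ↭ ys → Unique xs → ∀ ρ → hits xs ρ ≡ hits ys ρ
  hits-↭ Perm.refl         u ρ = refl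
  hits-↭ (Perm.prep x p)   u   = hits-prep x (hits-↭ p (Unique-tail u)) (∈-resp-↭ p) (∈-resp-↭ (↭-sym p))
  hits-↭ (Perm.swap x y p) u ρ = trans
    (hits-prep x (hits-prep y (hits-↭ p (Unique-tail (Unique-tail u))) (∈-resp-↭ p) (∈-resp-↭ (↭-sym p)))
       (∈-resp-↭ (Perm.prep y p)) (∈-resp-↭ (↭-sym (Perm.prep y p))) ρ)
    (hits-swap x y _ ρ (Unique-↭ (Perm.prep x (Perm.prep y p)) u))
  hits-↭ (Perm.trans p q)  u ρ = trans (hits-↭ p u ρ) (hits-↭ q (Unique-↭ p u) ρ)

module _ {n : ℕ} where

  iter-suc : ∀ (f : Fun n) k x → iter f (suc k) x ≡ iter f k (f x)
  iter-suc f zero    x = refl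
  iter-suc f (suc k) x = cong f (iter-suc f k x)

  iter-+ : ∀ (f : Fun n) j k x → iter f (j + k) x ≡ iter f j (iter f k x)
  iter-+ f zero    k x = refl
  iter-+ f (suc j) k x = cong f (iter-+ f j k x)

  Reach : Fun n → Fin n → Fin n → Set
  Reach f a b = Σ ℕ λ k → iter f k a ≡ b

  reach-refl : ∀ {f a} → Reach f a a
  reach-refl = 0 , refl

  reach-trans : ∀ {f a b c} → Reach f a b → Reach f b c → Reach f a c
  reach-trans {f} {a} (k , e) (j , e') = j + k , trans (iter-+ f j k a) (trans (cong (iter f j) e) e')

  reach-step : ∀ {f a b} → f a ≡ b → Reach f a b
  reach-step e = 1 , e

  -- Pigeonhole: a point reached in k steps is reached in fewer than n steps.
  reach-within-n : ∀ (f : Fun n) x y fuel k → k < fuel → iter f k x ≡ y → Σ (Fin n) λ i → iter f (toℕ i) x ≡ y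
  reach-within-n f x y (suc fuel) k (s≤s k≤fuel) e with k <? n
  ... | yes k<n = fromℕ< k<n , trans (cong (λ t → iter f t x) (toℕ-fromℕ< k<n)) e
  ... | no k≮n with pigeonhole {n} {suc n} ≤-refl (λ i → iter f (toℕ i) x)
  ...   | i , j , i<j , repeat = reach-within-n f x y fuel k' (<-≤-trans shorter k≤fuel) e'
    where
    j≤k : toℕ j ≤ k
    j≤k = ≤-trans (s≤s⁻¹ (toℕ<n j)) (≮⇒≥ k≮n)
    -- skip the loop between steps i and j
    k' : ℕ
    k' = (k ∸ toℕ j) + toℕ i
    shorter : k' < k
    shorter = subst (k' <_) (m∸n+n≡m j≤k) (+-monoʳ-< (k ∸ toℕ j) i<j)
    e' : iter f k' x ≡ y
    e' = begin
      iter f k' x                            ≡⟨ iter-+ f (k ∸ toℕ j) (toℕ i) x ⟩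
      iter f (k ∸ toℕ j) (iter f (toℕ i) x) ≡⟨ cong (iter f (k ∸ toℕ j)) repeat ⟩
      iter f (k ∸ toℕ j) (iter f (toℕ j) x) ≡⟨ sym (iter-+ f (k ∸ toℕ j) (toℕ j) x) ⟩
      iter f (k ∸ toℕ j + toℕ j) x          ≡⟨ cong (λ t → iter f t x) (m∸n+n≡m j≤k) ⟩
      iter f k x                             ≡⟨ e ⟩
      y                                      ∎
      where open ≡-Reasoning

  reach⇒NCycle : ∀ (f : Fun n) → (∀ a b → Reach f a b) → IsNCycle f
  reach⇒NCycle f reach a b with reach a b
  ... | k , e = reach-within-n f a b (suc k) k ≤-refl e

injective⇒surjective : ∀ {n} (s : Fun n) → (∀ {a b} → s a ≡ s b → a ≡ b) → ∀ y → Σ (Fin n) λ x → s x ≡ y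
injective⇒surjective {suc m} s inj y with any? (λ x → s x ≟ y)
... | yes hit = hit
... | no miss with pigeonhole {m} {suc m} ≤-refl (λ x → punchOut {i = y} {j = s x} (λ e → miss (x , sym e)))
...   | i , j , i<j , e =
  ⊥-elim (<-irrefl (cong toℕ (inj (punchOut-injective {i = y} (λ e → miss (i , sym e)) (λ e → miss (j , sym e)) e))) i<j)

-- An n-cycle is injective: it has a section s (y is reached from π y), which
-- is injective hence surjective, so π is its two-sided inverse.
NCycle-injective : ∀ {n} (π : Fun n) → IsNCycle π → ∀ {a b} → π a ≡ π b → a ≡ b
NCycle-injective {n} π cyc {a} {b} e = begin
  a                      ≡⟨ sym (proj₂ (preimage a)) ⟩
  s (proj₁ (preimage a)) ≡⟨ cong s same-preimage ⟩
  s (proj₁ (preimage b)) ≡⟨ proj₂ (preimage b) ⟩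
  b                      ∎
  where
  open ≡-Reasoning
  s : Fun n
  s y = iter π (toℕ (proj₁ (cyc (π y) y))) y
  π∘s : ∀ y → π (s y) ≡ y
  π∘s y = trans (iter-suc π (toℕ (proj₁ (cyc (π y) y))) y) (proj₂ (cyc (π y) y))
  preimage : ∀ y → Σ (Fin n) λ x → s x ≡ y
  preimage = injective⇒surjective s (λ {c} {d} e → trans (sym (π∘s c)) (trans (cong π e) (π∘s d)))
  same-preimage : proj₁ (preimage a) ≡ proj₁ (preimage b)
  same-preimage = trans (sym (π∘s _)) (trans (cong π (proj₂ (preimage a)))
                    (trans e (trans (cong π (sym (proj₂ (preimage b)))) (π∘s _))))

-- The invariant of the resampling induction.
module _ {n : ℕ} where

  record CyclicOff (q' F : List (Fin n)) (ρ : Fun n) : Set where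
    field
      fixes     : ∀ c → c ∈ F → ρ c ≡ c
      preserves : ∀ c → c ∉ F → ρ c ∉ F
      connected : ∀ a b → a ∉ F → b ∉ F → Reach ρ a b
      follows   : Follows q' ρ
  open CyclicOff

  CyclicOff-[] : ∀ {q' : List (Fin n)} {ρ} → CyclicOff q' [] ρ → InEvent q' ρ
  CyclicOff-[] I = reach⇒NCycle _ (λ a b → connected I a b (λ ()) (λ ())) , follows I

  -- If ρ fixes x and is a single cycle off x ∷ xs, then (x z) ∘ ρ, for z off
  -- x ∷ xs, is a single cycle off xs: x is inserted in front of z.
  insert-connected : ∀ {x : Fin n} {xs ρ z} → ρ x ≡ x → (∀ c → c ∉ x ∷ xs → ρ c ∉ x ∷ xs) →
    (∀ a b → a ∉ x ∷ xs → b ∉ x ∷ xs → Reach ρ a b) → z ∉ x ∷ xs →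
    ∀ a b → a ∉ xs → b ∉ xs → Reach (transpose x z ∘ ρ) a b
  insert-connected {x} {xs} {ρ} {z} ρx≡x preserved conn z∉ a b a∉ b∉ = cases (a ≟ x) (b ≟ x)
    where
    h : Fun n
    h = transpose x z ∘ ρ
    hx≡z : h x ≡ z
    hx≡z = trans (cong (transpose x z) ρx≡x) (transpose-i x z)
    off : ∀ {c} → c ≢ x → c ∉ xs → c ∉ x ∷ xs
    off c≢x c∉ (here e)  = c≢x e
    off c≢x c∉ (there m) = c∉ m
    -- every ρ-step outside x ∷ xs is an h-step, or two h-steps through x
    walk : ∀ c → c ∉ x ∷ xs → ∀ k → Reach h c (iter ρ k c) × iter ρ k c ∉ x ∷ xs
    walk c c∉ zero    = reach-refl , c∉
    walk c c∉ (suc k) with walk c c∉ k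
    ... | r , d∉ with ρ (iter ρ k c) ≟ z
    ...   | yes e = reach-trans r (reach-trans (reach-step (trans (cong (transpose x z) e) (transpose-j x z)))
                                               (reach-step (trans hx≡z (sym e)))) , preserved _ d∉
    ...   | no e  = reach-trans r (reach-step (transpose-other x z _ (preserved _ d∉ ∘ here) e)) , preserved _ d∉
    outside : ∀ c d → c ∉ x ∷ xs → d ∉ x ∷ xs → Reach h c d
    outside c d c∉ d∉ with conn c d c∉ d∉
    ... | k , e = subst (Reach h c) e (proj₁ (walk c c∉ k))
    -- x is entered from the ρ-predecessor of z
    into-x : Reach h z x
    into-x with conn (ρ z) z (preserved z z∉) z∉
    ... | k , e = reach-trans (proj₁ (walk z z∉ k)) (reach-step
      (trans (cong (transpose x z) (trans (iter-suc ρ k z) e)) (transpose-j x z)))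
    cases : Dec (a ≡ x) → Dec (b ≡ x) → Reach h a b
    cases (yes refl) (yes refl) = reach-refl
    cases (yes refl) (no b≢x)   = reach-trans (reach-step hx≡z) (outside z b z∉ (off b≢x b∉))
    cases (no a≢x)   (yes refl) = reach-trans (outside a z (off a≢x a∉) z∉) into-x
    cases (no a≢x)   (no b≢x)   = outside a b (off a≢x a∉) (off b≢x b∉)

  CyclicOff-step : ∀ {q' : List (Fin n)} {x xs ρ z} → CyclicOff q' (x ∷ xs) ρ → Unique (x ∷ xs) →
    z ∉ x ∷ xs → z ∉ tail q' → (∀ c → c ∈ x ∷ xs → c ∉ q') → CyclicOff q' xs (transpose x z ∘ ρ)
  CyclicOff-step {q'} {x} {xs} {ρ} {z} I u z∉ z∉tail disjoint = record
    { fixes     = fixes'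
    ; preserves = preserves'
    ; connected = insert-connected (fixes I x (here refl)) (preserves I) (connected I) z∉
    ; follows   = Follows-post q' (transpose x z) (follows I) (λ y m → transpose-other x z y
                    (λ e → disjoint x (here refl) (subst (_∈ q') e (∈-tail q' m))) (λ e → z∉tail (subst (_∈ tail q') e m)))
    }
    where
    x∉ : x ∉ xs
    x∉ = Unique[x∷xs]⇒x∉xs u
    fixes' : ∀ c → c ∈ xs → transpose x z (ρ c) ≡ c
    fixes' c m = trans (cong (transpose x z) (fixes I c (there m)))
      (transpose-other x z c (λ e → x∉ (subst (_∈ xs) e m)) (λ e → z∉ (there (subst (_∈ xs) e m))))
    preserves' : ∀ c → c ∉ xs → transpose x z (ρ c) ∉ xs
    preserves' c c∉ with c ≟ x
    ... | yes refl = subst (_∉ xs) (sym (trans (cong (transpose x z) (fixes I c (here refl))) (transpose-i c z))) (z∉ ∘ there)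
    ... | no c≢x with ρ c ≟ z
    ...   | yes e = subst (_∉ xs) (sym (trans (cong (transpose x z) e) (transpose-j x z))) x∉
    ...   | no e  = subst (_∉ xs) (sym (transpose-other x z (ρ c) (ρc∉ ∘ here) e)) (ρc∉ ∘ there)
      where
      ρc∉ : ρ c ∉ x ∷ xs
      ρc∉ = preserves I c (λ { (here e') → c≢x e' ; (there m) → c∉ m })

  -- If z is on the tail of q', no τ ∈ T(xs) can make τ (x z) ρ follow q':
  -- the predecessor of z would have to be mapped to z, but it goes to τ x.
  cannot-follow : ∀ (q' : List (Fin n)) {ρ τ x xs z} → Follows q' ρ → z ∈ tail q' → KeepsOutside xs τ →
    x ∉ xs → z ∉ x ∷ xs → ¬ Follows q' (τ ∘ transpose x z ∘ ρ)
  cannot-follow q' {ρ} {τ} {x} {xs} {z} F z∈tail keeps x∉ z∉ G with ∈tail⇒Adjacent q' z∈tail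
  ... | y , adj =
    [ (λ e → z∉ (here (trans (sym τx≡z) e))) , (λ m → z∉ (there (subst (_∈ xs) τx≡z m))) ]′ (keeps x x∉)
    where
    τx≡z : τ x ≡ z
    τx≡z = trans (cong τ (sym (trans (cong (transpose x z) (Follows-adjacent F adj)) (transpose-j x z))))
                    (Follows-adjacent G adj)

  first-exit-reach : ∀ (f g : Fun n) (F : List (Fin n)) → (∀ c → c ∉ F → g c ∉ F) →
    (∀ c → c ∉ F → Σ ℕ λ m → (1 ≤ m) × (g c ≡ iter f m c) × (∀ i → 1 ≤ i → i < m → iter f i c ∈ F)) →
    ∀ k a → a ∉ F → iter f k a ∉ F → Reach g a (iter f k a)
  first-exit-reach f g F preserved jump k a = go (suc k) k a ≤-refl
    where
    go : ∀ fuel k a → k < fuel → a ∉ F → iter f k a ∉ F → Reach g a (iter f k a)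
    go (suc fuel) zero    a _ _ _ = reach-refl
    go (suc fuel) (suc k) a (s≤s k≤fuel) a∉ k∉ with jump a a∉
    ... | m , 1≤m , ga≡ , inside with m ≤? suc k
    ...   | no m≰ = ⊥-elim (k∉ (inside (suc k) (s≤s z≤n) (≰⇒> m≰)))
    ...   | yes m≤ = subst (Reach g a) rest≡ (reach-trans (reach-step refl)
                       (go fuel (suc k ∸ m) (g a) (≤-trans (remaining 1≤m) k≤fuel) (preserved a a∉)
                           (subst (_∉ F) (sym rest≡) k∉)))
      where
      rest≡ : iter f (suc k ∸ m) (g a) ≡ iter f (suc k) a
      rest≡ = trans (cong (iter f (suc k ∸ m)) ga≡)
                (trans (sym (iter-+ f (suc k ∸ m) m a)) (cong (λ t → iter f t a) (m∸n+n≡m m≤)))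
      remaining : ∀ {m} → 1 ≤ m → suc (suc k ∸ m) ≤ suc k
      remaining {suc m} _ = s≤s (m∸n≤m k m)

  Follows-iter-last : ∀ (x : Fin n) t {f} → Follows (x ∷ t) f → iter f (length t) x ≡ last x t
  Follows-iter-last x []      F = refl
  Follows-iter-last x (b ∷ r) {f} (e , F) =
    trans (iter-suc f (length r) x) (trans (cong (iter f (length r)) e) (Follows-iter-last b r F))

  Follows-iter-dropLast : ∀ (x : Fin n) t {f} → Follows (x ∷ t) f → ∀ i → i < length t → iter f i x ∈ dropLast (x ∷ t)
  Follows-iter-dropLast x (b ∷ r)     F       zero    _          = here refl
  Follows-iter-dropLast x (b ∷ r) {f} (e , F) (suc i) (s≤s i<) =
    there (subst (_∈ dropLast (b ∷ r)) (sym (trans (iter-suc f i x) (cong (iter f i) e))) (Follows-iter-dropLast b r F i i<))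

  successor-off-dropLast : ∀ (x : Fin n) t {π} → (∀ {a b} → π a ≡ π b → a ≡ b) → Follows (x ∷ t) π →
    ∀ c → c ∉ dropLast (x ∷ t) → π c ≡ x ⊎ π c ∉ x ∷ t
  successor-off-dropLast x t {π} inj F c c∉ with π c ≟ x | π c ∈? t
  ... | yes e  | _        = inj₁ e
  ... | no _   | yes m    with ∈tail⇒Adjacent (x ∷ t) m
  ...   | d , adj = ⊥-elim (c∉ (subst (_∈ dropLast (x ∷ t)) (inj (Follows-adjacent F adj)) (Adjacent⇒∈dropLast adj)))
  successor-off-dropLast x t {π} inj F c c∉ | no ≢x | no ∉t = inj₂ λ { (here e) → ≢x e ; (there m) → ∉t m }

  CyclicOff-initial : ∀ (x : Fin n) t (q' : List (Fin n)) (π : Fun n) → Unique (x ∷ t) →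
    (∀ c → c ∈ x ∷ t → c ∉ q') → IsNCycle π → Follows (x ∷ t) π → Follows q' π →
    CyclicOff q' (dropLast (x ∷ t)) (lam (x ∷ t) ∘ π)
  CyclicOff-initial x t q' π u disjoint cyc Fq Fq' = record
    { fixes     = lam-undoes u Fq
    ; preserves = preserves'
    ; connected = λ a b a∉ b∉ → let (k , e) = cyc a (b) in
        subst (Reach (λq ∘ π) a) e (first-exit-reach π (λq ∘ π) A preserves' jump (toℕ k) a a∉ (subst (_∉ A) (sym e) b∉))
    ; follows   = Follows-post q' λq Fq' (λ y m → lam-outside q y (λ m' → disjoint y m' (∈-tail q' m)))
    }
    where
    q A : List (Fin n)
    q = x ∷ t
    A = dropLast q
    λq : Fun n
    λq = lam q
    successor : ∀ c → c ∉ A → π c ≡ x ⊎ π c ∉ q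
    successor = successor-off-dropLast x t (NCycle-injective π cyc) Fq
    preserves' : ∀ c → c ∉ A → λq (π c) ∉ A
    preserves' c c∉ with successor c c∉
    ... | inj₁ e  = subst (_∉ A) (sym (trans (cong λq e) (lam-head x t u))) (last∉dropLast u)
    ... | inj₂ ∉q = subst (_∉ A) (sym (lam-outside q (π c) ∉q)) (∉q ∘ ∈-dropLast)
    -- λ^q π c is π c when π c is off the path, and otherwise the end of the
    -- path, reached from c by walking along it.
    jump : ∀ c → c ∉ A →
      Σ ℕ λ m → (1 ≤ m) × (λq (π c) ≡ iter π m c) × (∀ i → 1 ≤ i → i < m → iter π i c ∈ A)
    jump c c∉ with successor c c∉
    ... | inj₂ ∉q = 1 , s≤s z≤n , lam-outside q (π c) ∉q , λ { (suc zero) _ (s≤s ()) ; (suc (suc i)) _ (s≤s ()) }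
    ... | inj₁ e  = suc (length t) , s≤s z≤n , reaches-last , inside
      where
      along : ∀ i → iter π (suc i) c ≡ iter π i x
      along i = trans (iter-suc π i c) (cong (iter π i) e)
      reaches-last : λq (π c) ≡ iter π (suc (length t)) c
      reaches-last = trans (cong λq e) (trans (lam-head x t u) (sym (trans (along (length t)) (Follows-iter-last x t Fq))))
      inside : ∀ i → 1 ≤ i → i < suc (length t) → iter π i c ∈ A
      inside (suc i) _ (s≤s i<) = subst (_∈ A) (sym (along i)) (Follows-iter-dropLast x t Fq i i<)

module Resampling {n : ℕ} (D : Fun n → Set) (D? : ∀ f → Dec (D f)) (D-resp : ∀ {f g} → EqFun f g → D f → D g) where
  open Hits D D? D-resp

  pairCount : List (Fin n) → List (Fin n) → Fun n → ℕ
  pairCount q q' π = ΣL (λ σ → ΣL (λ σ' →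
    when (inEvent? q' (resample q π σ)) 1 * when (D? (resample q' (resample q π σ) σ')) 1) (Ylist q')) (Ylist q)

  module _ (y : Fin n) (ys : List (Fin n)) (u' : Unique (y ∷ ys)) where
    private
      q' B : List (Fin n)
      q' = y ∷ ys
      B  = dropLast q'
      ℓ : Fin n
      ℓ  = last y ys
      λ' : Fun n
      λ' = lam q'

    -- Off the vertices F = x ∷ xs, the summation variable of the left side of
    -- resample-sum contributes 0 on the tail of q' and H (λ' z) elsewhere,
    -- which reindexes the sum: y is sent to the last vertex ℓ, all other
    -- contributing z stay off q'.
    reindex-left : ∀ (F : List (Fin n)) (g H : Fin n → ℕ) → (∀ c → c ∈ F → c ∉ q') →
      (∀ z → z ∉ F → z ∈ ys → g z ≡ 0) → (∀ z → z ∉ F → z ∉ ys → g z ≡ H (λ' z)) →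
      ∀ z → when (z ∉? F) (g z) ≡ when (z ≟ y) (H ℓ) + when ((z ∉? F) ×-dec (z ∉? q')) (H z)
    reindex-left F g H disjoint on-tail off-tail z = cases (z ∈? F) (z ∈? ys) (z ≟ y)
      where
      K : ℕ
      K = when ((z ∉? F) ×-dec (z ∉? q')) (H z)
      cases : Dec (z ∈ F) → Dec (z ∈ ys) → Dec (z ≡ y) → when (z ∉? F) (g z) ≡ when (z ≟ y) (H ℓ) + K
      cases (yes z∈) _ _ = trans (when-no (z ∉? F) (λ z∉ → z∉ z∈)) (sym (cong₂ _+_
        (when-no (z ≟ y) (λ e → disjoint z z∈ (here e)))
        (when-no ((z ∉? F) ×-dec (z ∉? q')) (λ p → proj₁ p z∈))))
      cases (no z∉) (yes z∈ys) _ = trans (when-yes (z ∉? F) z∉) (trans (on-tail z z∉ z∈ys) (sym (cong₂ _+_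
        (when-no (z ≟ y) (λ e → Unique[x∷xs]⇒x∉xs u' (subst (_∈ ys) e z∈ys)))
        (when-no ((z ∉? F) ×-dec (z ∉? q')) (λ p → proj₂ p (there z∈ys))))))
      cases (no z∉) (no z∉ys) (yes refl) = trans (when-yes (z ∉? F) z∉) (trans (off-tail z z∉ z∉ys)
        (trans (cong H (lam-head y ys u')) (sym (trans
          (cong₂ _+_ (when-yes (z ≟ z) refl) (when-no ((z ∉? F) ×-dec (z ∉? q')) (λ p → proj₂ p (here refl))))
          (+-identityʳ (H ℓ))))))
      cases (no z∉) (no z∉ys) (no z≢y) = trans (when-yes (z ∉? F) z∉) (trans (off-tail z z∉ z∉ys)
        (trans (cong H (lam-outside q' z z∉q'))
          (sym (cong₂ _+_ (when-no (z ≟ y) z≢y) (when-yes ((z ∉? F) ×-dec (z ∉? q')) (z∉ , z∉q'))))))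
        where
        z∉q' : z ∉ q'
        z∉q' (here e)  = z≢y e
        z∉q' (there m) = z∉ys m

    reindex-right : ∀ x xs (H : Fin n → ℕ) → (∀ c → c ∈ x ∷ xs → c ∉ q') →
      ∀ v → when (v ∉? (x ∷ (xs ++ B))) (H v) ≡ when (v ≟ ℓ) (H ℓ) + when ((v ∉? (x ∷ xs)) ×-dec (v ∉? q')) (H v)
    reindex-right x xs H disjoint v = cases (v ≟ ℓ)
      where
      cases : Dec (v ≡ ℓ) →
        when (v ∉? (x ∷ (xs ++ B))) (H v) ≡ when (v ≟ ℓ) (H ℓ) + when ((v ∉? (x ∷ xs)) ×-dec (v ∉? q')) (H v)
      cases (yes refl) = trans (when-yes (v ∉? (x ∷ (xs ++ B))) ℓ∉)
        (sym (trans (cong₂ _+_ (when-yes (v ≟ v) refl)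
                               (when-no ((v ∉? (x ∷ xs)) ×-dec (v ∉? q')) (λ p → proj₂ p (last-∈ y ys))))
                    (+-identityʳ (H ℓ))))
        where
        ℓ∉ : ℓ ∉ x ∷ (xs ++ B)
        ℓ∉ (here e)  = disjoint x (here refl) (subst (_∈ q') e (last-∈ y ys))
        ℓ∉ (there m) = [ (λ p → disjoint ℓ (there p) (last-∈ y ys)) , last∉dropLast u' ]′ (∈-++⁻ xs m)
      cases (no v≢ℓ) = sym (trans (cong (_+ when ((v ∉? (x ∷ xs)) ×-dec (v ∉? q')) (H v)) (when-no (v ≟ ℓ) v≢ℓ))
        (when-cong ((v ∉? (x ∷ xs)) ×-dec (v ∉? q')) (v ∉? (x ∷ (xs ++ B))) join split (λ _ → refl)))
        where
        join : v ∉ x ∷ xs × v ∉ q' → v ∉ x ∷ (xs ++ B)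
        join (v∉ , v∉q') (here e)  = v∉ (here e)
        join (v∉ , v∉q') (there m) = [ v∉ ∘ there , v∉q' ∘ ∈-dropLast ]′ (∈-++⁻ xs m)
        split : v ∉ x ∷ (xs ++ B) → v ∉ x ∷ xs × v ∉ q'
        split v∉ = (λ { (here e) → v∉ (here e) ; (there m) → v∉ (there (∈-++⁺ˡ m)) })
                 , (λ m → [ v∉ ∘ there ∘ ∈-++⁺ʳ xs , v≢ℓ ]′ (∈-dropLast-or-last m))

    -- The first transposition (x z) of σ either
    -- breaks q' (z on the tail of q') or, conjugated through λ', becomes the
    -- first transposition (x λ'z) of the right side.
    resample-sum : ∀ xs → Unique xs → (∀ c → c ∈ xs → c ∉ q') → ∀ ρ → CyclicOff q' xs ρ →
      ΣL (λ σ → when (inEvent? q' (σ ∘ ρ)) 1 * hits B (λ' ∘ σ ∘ ρ)) (Tlist xs) ≡ hits (xs ++ B) (λ' ∘ ρ)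
    resample-sum [] u disjoint ρ I rewrite when-yes (inEvent? q' ρ) {1} (CyclicOff-[] I) =
      trans (+-identityʳ _) (+-identityʳ _)
    resample-sum (x ∷ xs) u disjoint ρ I = begin
      ΣL f (Tlist (x ∷ xs))
        ≡⟨ ΣT-cons x xs f ⟩
      ΣL (λ z → when (z ∉? (x ∷ xs)) (inner z)) (allFin n)
        ≡⟨ ΣL-cong (allFin n) (reindex-left (x ∷ xs) inner h disjoint inner-tail inner-off) ⟩
      ΣL (λ z → when (z ≟ y) (h ℓ) + K z) (allFin n)
        ≡⟨ trans (ΣL-δ-+ y (h ℓ) K) (sym (ΣL-δ-+ ℓ (h ℓ) K)) ⟩
      ΣL (λ v → when (v ≟ ℓ) (h ℓ) + K v) (allFin n)
        ≡⟨ sym (ΣL-cong (allFin n) (reindex-right x xs h disjoint)) ⟩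
      ΣL (λ v → when (v ∉? (x ∷ (xs ++ B))) (h v)) (allFin n)
        ≡⟨ sym (hits-cons x (xs ++ B) (λ' ∘ ρ)) ⟩
      hits (x ∷ (xs ++ B)) (λ' ∘ ρ) ∎
      where
      open ≡-Reasoning
      f : Fun n → ℕ
      f σ = when (inEvent? q' (σ ∘ ρ)) 1 * hits B (λ' ∘ σ ∘ ρ)
      inner : Fin n → ℕ
      inner z = ΣL (λ τ → f (τ ∘ transpose x z)) (Tlist xs)
      h : Fin n → ℕ
      h v = hits (xs ++ B) (transpose x v ∘ λ' ∘ ρ)
      K : Fin n → ℕ
      K z = when ((z ∉? (x ∷ xs)) ×-dec (z ∉? q')) (h z)
      inner-tail : ∀ z → z ∉ x ∷ xs → z ∈ ys → inner z ≡ 0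
      inner-tail z z∉ z∈ys = ΣT-vanish xs (Unique-tail u) _ (λ τ keeps →
        cong (_* hits B (λ' ∘ τ ∘ transpose x z ∘ ρ)) (when-no (inEvent? q' (τ ∘ transpose x z ∘ ρ))
          (λ ev → cannot-follow q' (CyclicOff.follows I) z∈ys keeps (Unique[x∷xs]⇒x∉xs u) z∉ (proj₂ ev))))
      inner-off : ∀ z → z ∉ x ∷ xs → z ∉ ys → inner z ≡ h (λ' z)
      inner-off z z∉ z∉ys = trans
        (resample-sum xs (Unique-tail u) (λ c m → disjoint c (there m)) (transpose x z ∘ ρ)
                      (CyclicOff-step I u z∉ z∉ys disjoint))
        (hits-cong (xs ++ B) (λ c → lam-conj y ys u' x z (disjoint x (here refl)) z∉ys (ρ c)))

  module _ {x : Fin n} {t : List (Fin n)} {y : Fin n} {ys : List (Fin n)} {π : Fun n}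
           (u : Unique (x ∷ t)) (u' : Unique (y ∷ ys)) (disjoint : ∀ c → c ∈ x ∷ t → c ∉ y ∷ ys)
           (cyc : IsNCycle π) (Fq : Follows (x ∷ t) π) (Fq' : Follows (y ∷ ys) π) where
    private
      A B : List (Fin n)
      A = dropLast (x ∷ t)
      B = dropLast (y ∷ ys)

    pairCount≡hits : pairCount (x ∷ t) (y ∷ ys) π ≡ hits (A ++ B) (lam (y ∷ ys) ∘ lam (x ∷ t) ∘ π)
    pairCount≡hits = trans
      (ΣL-cong (Tlist A) (λ σ → ΣL-*ˡ (when (inEvent? (y ∷ ys) (σ ∘ lam (x ∷ t) ∘ π)) 1)
                                      (λ σ' → when (D? (σ' ∘ lam (y ∷ ys) ∘ σ ∘ lam (x ∷ t) ∘ π)) 1) (Tlist B)))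
      (resample-sum y ys u' A (Unique-dropLast u) (λ c m → disjoint c (∈-dropLast m)) (lam (x ∷ t) ∘ π)
                    (CyclicOff-initial x t (y ∷ ys) π u disjoint cyc Fq Fq'))

  -- Step 3: both orders of resampling give the same count, since both are
  -- hits of the concatenated lists, which may be reordered, and λ^q, λ^{q'}
  -- commute.
  pairCount-symmetric : ∀ {x : Fin n} {t y ys π} → Unique (x ∷ t) → Unique (y ∷ ys) →
    (∀ c → c ∈ x ∷ t → c ∉ y ∷ ys) → IsNCycle π → Follows (x ∷ t) π → Follows (y ∷ ys) π →
    pairCount (x ∷ t) (y ∷ ys) π ≡ pairCount (y ∷ ys) (x ∷ t) π
  pairCount-symmetric {x} {t} {y} {ys} {π} u u' disjoint cyc Fq Fq' = begin
    pairCount (x ∷ t) (y ∷ ys) π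
      ≡⟨ pairCount≡hits u u' disjoint cyc Fq Fq' ⟩
    hits (A ++ B) (lam (y ∷ ys) ∘ lam (x ∷ t) ∘ π)
      ≡⟨ hits-↭ (++-comm A B) (++⁺ (Unique-dropLast u) (Unique-dropLast u') A#B) _ ⟩
    hits (B ++ A) (lam (y ∷ ys) ∘ lam (x ∷ t) ∘ π)
      ≡⟨ hits-cong (B ++ A) (λ c → lam-commute (x ∷ t) (y ∷ ys) disjoint (π c)) ⟩
    hits (B ++ A) (lam (x ∷ t) ∘ lam (y ∷ ys) ∘ π)
      ≡⟨ sym (pairCount≡hits u' u disjoint' cyc Fq' Fq) ⟩
    pairCount (y ∷ ys) (x ∷ t) π ∎
    where
    open ≡-Reasoning
    A B : List (Fin n)
    A = dropLast (x ∷ t)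
    B = dropLast (y ∷ ys)
    A#B : ∀ {v} → ¬ (v ∈ A × v ∈ B)
    A#B (a , b) = disjoint _ (∈-dropLast a) (∈-dropLast b)
    disjoint' : ∀ c → c ∈ y ∷ ys → c ∉ x ∷ t
    disjoint' c m m' = disjoint c m' m

count-× : ∀ {A B : Set} {P Q : A × B → Set} (P? : ∀ p → Dec (P p)) (Q? : ∀ p → Dec (Q p)) l m →
  count (λ p → P? p ×-dec Q? p) (cartesianProduct l m) ≡ ΣL (λ a → ΣL (λ b → when (P? (a , b)) 1 * when (Q? (a , b)) 1) m) l
count-× P? Q? l m = trans (count≡ΣL _ (cartesianProduct l m)) (trans (ΣL-cartesianProduct _ l m)
  (ΣL-cong l (λ a → ΣL-cong m (λ b → when-× (P? (a , b)) (Q? (a , b))))))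

count-pairs : ∀ {A B : Set} {P : A × B → Set} (P? : ∀ p → Dec (P p)) l m →
  count P? (cartesianProduct l m) ≡ ΣL (λ a → ΣL (λ b → when (P? (a , b)) 1 * 1) m) l
count-pairs P? l m = trans (count≡ΣL _ (cartesianProduct l m)) (trans (ΣL-cartesianProduct _ l m)
  (ΣL-cong l (λ a → ΣL-cong m (λ b → sym (*-identityʳ _)))))

module Equals {n : ℕ} (w : Fun n) = Resampling (λ f → EqFun f w) (λ f → eqFun? f w) (λ e h c → trans (sym (e c)) (h c))
module Always {n : ℕ} = Resampling {n} (λ _ → ⊤) (λ _ → yes tt) (λ _ _ → tt)

module _ {n : ℕ} (q q' : List (Fin n)) (π w : Fun n) where

  numL≡pairCount : numL q q' π w ≡ Equals.pairCount w q q' π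
  numL≡pairCount = count-× (λ p → inEvent? q' (resample q π (proj₁ p)))
                            (λ p → eqFun? (resample q' (resample q π (proj₁ p)) (proj₂ p)) w) (Ylist q) (Ylist q')

  numR≡pairCount : numR q q' π w ≡ Equals.pairCount w q' q π
  numR≡pairCount = trans (count-× (λ p → inEvent? q (resample q' π (proj₂ p)))
                                      (λ p → eqFun? (resample q (resample q' π (proj₂ p)) (proj₁ p)) w) (Ylist q) (Ylist q'))
                            (ΣL-swap _ (Ylist q) (Ylist q'))

  denL≡pairCount : denL q q' π w ≡ Always.pairCount q q' π
  denL≡pairCount = count-pairs (λ p → inEvent? q' (resample q π (proj₁ p))) (Ylist q) (Ylist q')

  denR≡pairCount : denR q q' π w ≡ Always.pairCount q' q π
  denR≡pairCount = trans (count-pairs (λ p → inEvent? q (resample q' π (proj₂ p))) (Ylist q) (Ylist q'))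
                         (ΣL-swap _ (Ylist q) (Ylist q'))

mainTheorem16 : (n : ℕ) (q q' : List (Fin n)) → IsPath q → IsPath q' →
    ¬ Dependent q q' →
    (π : Fun n) → InEvent q π → InEvent q' π →
    (w : Fun n) → IsNCycle w →
    numL q q' π w * denR q q' π w ≡ numR q q' π w * denL q q' π w
mainTheorem16 n []      q'       (_ , ()) _        _ _ _ _ _ _
mainTheorem16 n (x ∷ t) []       _        (_ , ()) _ _ _ _ _ _
mainTheorem16 n (x ∷ t) (y ∷ ys) (u , _) (u' , _) independent π (cyc , Fq) (_ , Fq') w _ =
  cong₂ _*_ numerators (sym denominators)
  where
  q q' : List (Fin n)
  q = x ∷ t
  q' = y ∷ ys
  disjoint : ∀ c → c ∈ q → c ∉ q'
  disjoint c m m' = independent (c , m , m')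
  numerators : numL q q' π w ≡ numR q q' π w
  numerators = trans (numL≡pairCount q q' π w) (trans
    (Equals.pairCount-symmetric w u u' disjoint cyc Fq Fq') (sym (numR≡pairCount q q' π w)))
  denominators : denL q q' π w ≡ denR q q' π w
  denominators = trans (denL≡pairCount q q' π w) (trans
    (Always.pairCount-symmetric u u' disjoint cyc Fq Fq') (sym (denR≡pairCount q q' π w)))
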